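{- The rule $E_\bot$ is derivable in $ALFA_{Io}$: for every graph $A$, $[\,]\vdash_{ALFA_{Io}}A$.
   Context: Graphs: the empty graph $\emptyset$ and propositional letters are graphs; if $G,H$ are graphs then so are the juxtaposition $GH$, the cut $[G]$ ($G$ inside a solid closed curve), the implication graph $\langle G\Rightarrow H\rangle$ (a solid closed curve containing $G$ and a dotted closed curve containing $H$), and the disjunction graph $\langle G\vee H\rangle$ (a solid closed curve containing two semi-dotted closed curves, one containing $G$ and one containing $H$; $\langle G\vee H\rangle=\langle H\vee G\rangle$). Juxtaposition is associative and commutative with unit $\emptyset$; $[\,]$ is the empty cut. Rules are schemata with $A,B,C$ arbitrary (possibly empty) graphs, applied to the whole graph on the sheet. The system $ALFA_{Io}$ has first-degree rules $MP_i: A\langle A\Rightarrow B\rangle\vdash B$; $I_\vee: A\vdash\langle A\vee B\rangle$; $R_2: AB\vdash A$; $I_{p3}:\langle A\vee B\rangle\vdash\langle[A]\Rightarrow B\rangle$; $I_{p2}: [AB]\vdash\langle A\Rightarrow[B]\rangle$; $E_p:\langle A\Rightarrow B\rangle\vdash[A[B]]$; and second-degree rules $R_{8i}$: if $AB\vdash C$ then $A\vdash\langle B\Rightarrow C\rangle$; $R_0$: if $A\vdash B$ and $A\vdash C$ then $A\vdash BC$; $E_\vee$: if $A\vdash C$ and $B\vdash C$ then $\langle A\vee B\rangle\vdash C$. $\vdash_{ALFA_{Io}}$ is the least transitive relation on graphs containing all instances of the first-degree rules and closed under the second-degree rules. -}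

module Defs where

open import Data.Nat using (ℕ)
open import Data.List using (List; []; _∷_; _++_; [_])

-- A graph is a juxtaposition (list) of items; the empty list
-- is the empty graph ∅ and juxtaposition is list concatenation (hence
-- associative with unit ∅ definitionally). Commutativity of juxtaposition
-- and the symmetry ⟨G ∨ H⟩ = ⟨H ∨ G⟩ are handled by the structural
-- equivalence _≈_ below.
mutual
  data Item : Set where
    letter : ℕ → Item
    cut    : Graph → Item
    imp    : Graph → Graph → Item
    disj   : Graph → Graph → Item

  Graph : Set
  Graph = List Item

∅ : Graph
∅ = []

_·_ : Graph → Graph → Graph
G · H = G ++ H

[_]ᶜ : Graph → Graph
[ G ]ᶜ = [ cut G ]

⟨_⇒_⟩ : Graph → Graph → Graph
⟨ G ⇒ H ⟩ = [ imp G H ]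

⟨_∨_⟩ : Graph → Graph → Graph
⟨ G ∨ H ⟩ = [ disj G H ]

emptyCut : Graph
emptyCut = [ ∅ ]ᶜ

infix 4 _≈_
data _≈_ : Graph → Graph → Set where
  ≈-refl  : ∀ {G} → G ≈ G
  ≈-sym   : ∀ {G H} → G ≈ H → H ≈ G
  ≈-trans : ∀ {G H K} → G ≈ H → H ≈ K → G ≈ K
  ≈-swap  : ∀ {G H} → G · H ≈ H · G
  ≈-juxt  : ∀ {G G' H H'} → G ≈ G' → H ≈ H' → G · H ≈ G' · H'
  ≈-cut   : ∀ {G G'} → G ≈ G' → [ G ]ᶜ ≈ [ G' ]ᶜ
  ≈-imp   : ∀ {G G' H H'} → G ≈ G' → H ≈ H' → ⟨ G ⇒ H ⟩ ≈ ⟨ G' ⇒ H' ⟩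
  ≈-disj  : ∀ {G G' H H'} → G ≈ G' → H ≈ H' → ⟨ G ∨ H ⟩ ≈ ⟨ G' ∨ H' ⟩
  ≈-disjC : ∀ {G H} → ⟨ G ∨ H ⟩ ≈ ⟨ H ∨ G ⟩

infix 3 _⊢_
data _⊢_ : Graph → Graph → Set where
  ident : ∀ {G H} → G ≈ H → G ⊢ H
  trans : ∀ {G H K} → G ⊢ H → H ⊢ K → G ⊢ K
  MPi : ∀ {A B} → A · ⟨ A ⇒ B ⟩ ⊢ B
  I∨  : ∀ {A B} → A ⊢ ⟨ A ∨ B ⟩
  R2  : ∀ {A B} → A · B ⊢ A
  Ip3 : ∀ {A B} → ⟨ A ∨ B ⟩ ⊢ ⟨ [ A ]ᶜ ⇒ B ⟩
  Ip2 : ∀ {A B} → [ A · B ]ᶜ ⊢ ⟨ A ⇒ [ B ]ᶜ ⟩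
  Ep  : ∀ {A B} → ⟨ A ⇒ B ⟩ ⊢ [ A · [ B ]ᶜ ]ᶜ
  R8i : ∀ {A B C} → A · B ⊢ C → A ⊢ ⟨ B ⇒ C ⟩
  R0  : ∀ {A B C} → A ⊢ B → A ⊢ C → A ⊢ B · C
  E∨  : ∀ {A B C} → A ⊢ C → B ⊢ C → ⟨ A ∨ B ⟩ ⊢ C

module Submission where

open import Defs

-- Every graph proves the empty graph ∅; by I∨ and I_{p3} the empty graph
-- proves ⟨[ ] ⇒ A⟩, and modus ponens with [ ] itself then yields A.

⊢-empty : (G : Graph) → G ⊢ ∅
⊢-empty G = R2 {∅} {G}

empty⊢emptyCut⇒ : (A : Graph) → ∅ ⊢ ⟨ emptyCut ⇒ A ⟩
empty⊢emptyCut⇒ A = trans (I∨ {∅} {A}) Ip3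

⊢-modusPonens : ∀ {G A B} → G ⊢ A → G ⊢ ⟨ A ⇒ B ⟩ → G ⊢ B
⊢-modusPonens G⊢A G⊢A⇒B = trans (R0 G⊢A G⊢A⇒B) MPi

mainTheorem14 : (A : Graph) → emptyCut ⊢ A
mainTheorem14 A =
  ⊢-modusPonens (ident ≈-refl) (trans (⊢-empty emptyCut) (empty⊢emptyCut⇒ A))
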